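{- Let $a\in\mathbb{N}$ with $a\geq 3$. For every $i\in\mathbb{N}$, $f_a+f_{a+i}\in\langle f_a+f_0,\ f_a+f_{a-1}\rangle$.
   Context: $\{f_n\}$ is the Fibonacci sequence ($f_0=0$, $f_1=1$, $f_{n+2}=f_{n+1}+f_n$). $\langle X\rangle$ denotes the submonoid of $(\mathbb{N},+)$ generated by $X$, i.e. all finite $\mathbb{N}$-linear combinations of elements of $X$. -}

module Defs where

open import Data.Nat using (ℕ; zero; suc; _+_)
open import Data.List using (List)
open import Data.List.Membership.Propositional using (_∈_)

fib : ℕ → ℕ
fib zero = zero
fib (suc zero) = suc zero
fib (suc (suc n)) = fib (suc n) + fib n

-- ⟨ X ⟩ for a finite list X of generators: the submonoid of (ℕ,+)
-- generated by X, i.e. all finite ℕ-linear combinations of elements of X.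
data ⟨_⟩ (X : List ℕ) : ℕ → Set where
  gen-zero : ⟨ X ⟩ 0
  gen-add  : ∀ {x m} → x ∈ X → ⟨ X ⟩ m → ⟨ X ⟩ (x + m)

{-# OPTIONS --safe #-}
-- By the addition formula f_{a+i} = f_a f_{i+1} + f_{a-1} f_i, so for i = j + 1
--   f_a + f_{a+i} = (1 + f_j) f_a + f_{j+1} (f_a + f_{a-1}),
-- using f_{j+2} = f_{j+1} + f_j; for i = 0 the sum is simply 2 f_a.
module Submission where

open import Defs
open import Data.Nat using (ℕ; _+_; _∸_; _≥_; _*_; zero; suc)
open import Data.List using (List; _∷_; [])
open import Data.List.Membership.Propositional using (_∈_)
open import Data.List.Relation.Unary.Any using (here; there)
open import Data.Nat.Properties using (+-suc; +-assoc; +-identityʳ)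
open import Data.Nat.Tactic.RingSolver using (solve-∀)
open import Relation.Binary.PropositionalEquality
  using (_≡_; refl; sym; cong; subst; module ≡-Reasoning)
open ≡-Reasoning

fib-+ : ∀ m n → fib (suc (m + n)) ≡ fib (suc m) * fib (suc n) + fib m * fib n
fib-+ zero n = unit (fib (suc n)) (fib n)
  where
  unit : ∀ r s → r ≡ 1 * r + 0 * s
  unit = solve-∀
fib-+ (suc m) n = begin
  fib (suc (suc m + n))                                      ≡⟨ cong (λ k → fib (suc k)) (sym (+-suc m n)) ⟩
  fib (suc (m + suc n))                                      ≡⟨ fib-+ m (suc n) ⟩
  fib (suc m) * (fib (suc n) + fib n) + fib m * fib (suc n)  ≡⟨ regroup (fib (suc m)) (fib m) (fib (suc n)) (fib n) ⟩
  (fib (suc m) + fib m) * fib (suc n) + fib (suc m) * fib n  ∎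
  where
  regroup : ∀ p q r s → p * (r + s) + q * r ≡ (p + q) * r + p * s
  regroup = solve-∀

⟨⟩-*+ : ∀ {X x m} k → x ∈ X → ⟨ X ⟩ m → ⟨ X ⟩ (k * x + m)
⟨⟩-*+ zero    x∈X m∈⟨X⟩ = m∈⟨X⟩
⟨⟩-*+ {X} {x} {m} (suc k) x∈X m∈⟨X⟩ =
  subst ⟨ X ⟩ (sym (+-assoc x (k * x) m)) (gen-add x∈X (⟨⟩-*+ k x∈X m∈⟨X⟩))

⟨⟩-linear : ∀ {x y} k l → ⟨ x ∷ y ∷ [] ⟩ (k * x + l * y)
⟨⟩-linear {x} {y} k l =
  subst ⟨ _ ⟩ (cong (k * x +_) (+-identityʳ (l * y)))
    (⟨⟩-*+ k (here refl) (⟨⟩-*+ l (there (here refl)) gen-zero))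

fib+fib-+-∈⟨⟩ : ∀ b i → ⟨ (fib (suc b) + fib 0) ∷ (fib (suc b) + fib b) ∷ [] ⟩ (fib (suc b) + fib (suc b + i))
fib+fib-+-∈⟨⟩ b zero = subst ⟨ _ ⟩ double (⟨⟩-linear 2 0)
  where
  double : 2 * (fib (suc b) + 0) + 0 * (fib (suc b) + fib b) ≡ fib (suc b) + fib (suc b + 0)
  double rewrite +-identityʳ b = twice (fib (suc b)) (fib b)
    where
    twice : ∀ p q → 2 * (p + 0) + 0 * (p + q) ≡ p + p
    twice = solve-∀
fib+fib-+-∈⟨⟩ b (suc j) = subst ⟨ _ ⟩ (sym combination) (⟨⟩-linear (suc (fib j)) (fib (suc j)))
  where
  F G : ℕ
  F = fib (suc b)
  G = fib b
  regroup : ∀ p q r s → p + (p * (r + s) + q * r) ≡ suc s * (p + 0) + r * (p + q)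
  regroup = solve-∀
  combination : F + fib (suc b + suc j) ≡ suc (fib j) * (F + 0) + fib (suc j) * (F + G)
  combination = begin
    F + fib (suc b + suc j)                                ≡⟨ cong (F +_) (fib-+ b (suc j)) ⟩
    F + (F * (fib (suc j) + fib j) + G * fib (suc j))      ≡⟨ regroup F G (fib (suc j)) (fib j) ⟩
    suc (fib j) * (F + 0) + fib (suc j) * (F + G)          ∎

lemma4 : (a : ℕ) → a ≥ 3 → (i : ℕ) →
    ⟨ (fib a + fib 0) ∷ (fib a + fib (a ∸ 1)) ∷ [] ⟩ (fib a + fib (a + i))
lemma4 zero    ()
lemma4 (suc b) _ i = fib+fib-+-∈⟨⟩ b i
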